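{- For every graph $G$, $b(G)-1\le b_L(G)\le b(G)+1$.
   Context: For a finite simple graph $H$, a burning sequence is a sequence $(b_1,\dots,b_t)$ of vertices such that every vertex $v$ satisfies $d_H(v,b_i)\le t-i$ for some $i\in\{1,\dots,t\}$; $b(H)$ is the minimum length of a burning sequence. The line graph $L(G)$ has vertex set $E(G)$, two vertices adjacent iff the edges share an endpoint. The edge burning number of $G$ is $b_L(G)=b(L(G))$. -}

module Defs where

open import Data.Nat using (ℕ; zero; suc; _∸_; _<_)
open import Data.Fin using (Fin; toℕ)
open import Data.Bool using (Bool; true; false)
open import Data.Product using (Σ; ∃; _×_; _,_; proj₁; proj₂)
open import Data.Sum using (_⊎_)
open import Relation.Binary.PropositionalEquality using (_≡_; _≢_)
open import Relation.Nullary using (¬_)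
open import Data.Fin using () renaming (_<_ to _<ᶠ_)

record Graph : Set where
  field
    n      : ℕ
    adj    : Fin n → Fin n → Bool
    sym    : ∀ u v → adj u v ≡ adj v u
    irrefl : ∀ v → adj v v ≡ false
open Graph public

-- Distances in a graph given by a vertex type V and adjacency relation.
-- Within A k u v  :  d(u,v) ≤ k, i.e. there is a walk of length ≤ k.
data Within {V : Set} (A : V → V → Set) : ℕ → V → V → Set where
  here : ∀ {k v} → Within A k v v
  step : ∀ {k u w v} → A u w → Within A k w v → Within A (suc k) u v

-- (b_1,…,b_t) is a burning sequence (b_{j+1} = bs j for j : Fin t):
-- every vertex v has d(v, b_i) ≤ t - i for some i.
IsBurningSeq : {V : Set} (A : V → V → Set) (t : ℕ) → (Fin t → V) → Set
IsBurningSeq {V} A t bs = ∀ (v : V) → ∃ λ (j : Fin t) → Within A (t ∸ suc (toℕ j)) v (bs j)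

IsBurningNumber : {V : Set} (A : V → V → Set) → ℕ → Set
IsBurningNumber {V} A m =
  (Σ (Fin m → V) λ bs → IsBurningSeq A m bs)
  × (∀ t → t < m → (bs : Fin t → V) → ¬ IsBurningSeq A t bs)

Vtx : Graph → Set
Vtx G = Fin (n G)

Adj : (G : Graph) → Vtx G → Vtx G → Set
Adj G u v = adj G u v ≡ true

Connected : Graph → Set
Connected G = ∀ (u v : Vtx G) → ∃ λ k → Within (Adj G) k u v

-- Edges of G: unordered pairs {u,v}, represented as (u , v) with u < v.
Edge : Graph → Set
Edge G = Σ (Vtx G × Vtx G) λ p → (proj₁ p <ᶠ proj₂ p) × Adj G (proj₁ p) (proj₂ p)

endpoints : (G : Graph) → Edge G → Vtx G × Vtx G
endpoints G e = proj₁ e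

_∈ₑ_ : {G : Graph} → Vtx G → Edge G → Set
_∈ₑ_ x e = (x ≡ proj₁ (proj₁ e)) ⊎ (x ≡ proj₂ (proj₁ e))

LAdj : (G : Graph) → Edge G → Edge G → Set
LAdj G e f = (proj₁ e ≢ proj₁ f) × ∃ λ (x : Vtx G) → (_∈ₑ_ {G} x e) × (_∈ₑ_ {G} x f)

BurningNumber : Graph → ℕ → Set
BurningNumber G m = IsBurningNumber (Adj G) m

EdgeBurningNumber : Graph → ℕ → Set
EdgeBurningNumber G m = IsBurningNumber (LAdj G) m

-- Walks transfer between G and L(G) at the cost of one step: if two edges
-- are at distance k in L(G), any endpoint of one is within k + 1 in G of any
-- endpoint of the other, and if two vertices are at distance k in G, any
-- edge through one is within k + 1 in L(G) of any edge through the other.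
-- Replacing each source of a burning sequence of L(G) by one of its
-- endpoints, or each source of a burning sequence of G by an edge through it,
-- therefore burns everything once every source gets one extra round, and an
-- extra round is bought by appending one more source at the end.  Connectivity
-- guarantees that every vertex lies on an edge unless G has a single vertex,
-- which the appended source then burns.
module Submission where

open import Defs hiding (sym)
open import Axiom.UniquenessOfIdentityProofs using (module Decidable⇒UIP)
open import Data.Bool using (true; false)
import Data.Bool.Properties as Bool
open import Data.Empty using (⊥-elim)
open import Data.Fin using (Fin; toℕ; _↑ˡ_; _↑ʳ_) renaming (zero to fzero)
open import Data.Fin.Properties using (any?; <-cmp; toℕ<n; toℕ-↑ˡ; _≟_)
open import Data.Nat using (ℕ; zero; suc; _≤_; _∸_; _+_; z≤n; s≤s)
open import Data.Nat.Properties
  using (≤-trans; n≤1+n; m≤n+m; ≮⇒≥; <-irrefl; <-irrelevant; +-comm; +-∸-comm; m+n∸n≡m; ∸-monoˡ-≤)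
open import Data.Product using (Σ; ∃; _×_; _,_; proj₁; proj₂)
open import Data.Product.Properties using (≡-dec)
open import Data.Sum using (_⊎_; inj₁; inj₂)
open import Function using (_∘_)
open import Data.Vec.Functional using (_++_; _∷_; [])
open import Data.Vec.Functional.Properties using (lookup-++ˡ; lookup-++ʳ)
open import Relation.Binary using (tri<; tri≈; tri>)
open import Relation.Binary.PropositionalEquality
  using (_≡_; refl; sym; trans; subst; subst₂)
open import Relation.Nullary using (¬_; Dec; yes; no)

module _ {V : Set} {A : V → V → Set} where

  within-≤ : ∀ {k m u v} → k ≤ m → Within A k u v → Within A m u v
  within-≤ _       here       = here
  within-≤ (s≤s p) (step a w) = step a (within-≤ p w)

  within-trans : ∀ {k m u v w} → Within A k u v → Within A m v w → Within A (k + m) u w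
  within-trans {k} {m} here q = within-≤ (m≤n+m m k) q
  within-trans (step a p) q   = step a (within-trans p q)

  burningNumber≤length : ∀ {m t} → IsBurningNumber A m →
    (bs : Fin t → V) → IsBurningSeq A t bs → m ≤ t
  burningNumber≤length {t = t} (_ , minimal) bs burns = ≮⇒≥ λ t<m → minimal t t<m bs burns

  -- Appending d as a last source gives every earlier source one extra round.
  burning-++ : ∀ {t} (bs : Fin t → V) (d : V) →
    (∀ v → v ≡ d ⊎ ∃ λ j → Within A (suc (t ∸ suc (toℕ j))) v (bs j)) →
    IsBurningSeq A (t + 1) (bs ++ (d ∷ []))
  burning-++ {t} bs d covered v with covered v
  ... | inj₁ refl = t ↑ʳ fzero , subst (Within A _ v) (sym (lookup-++ʳ bs (d ∷ []) fzero)) here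
  ... | inj₂ (j , w) = j ↑ˡ 1 , subst₂ (λ k u → Within A k v u) radius (sym (lookup-++ˡ bs (d ∷ []) j)) w
    where
    radius : suc (t ∸ suc (toℕ j)) ≡ t + 1 ∸ suc (toℕ (j ↑ˡ 1))
    radius rewrite toℕ-↑ˡ j 1 = trans (+-comm 1 _) (sym (+-∸-comm 1 (toℕ<n j)))

module _ (G : Graph) where

  Isolated : Vtx G → Set
  Isolated v = ∀ w → adj G v w ≡ false

  Incident : Vtx G → Set
  Incident v = Σ (Edge G) (_∈ₑ_ {G} v)

  ≡-Edge : {e f : Edge G} → proj₁ e ≡ proj₁ f → e ≡ f
  ≡-Edge {p , l , a} {.p , l′ , a′} refl
    rewrite <-irrelevant l l′ | Decidable⇒UIP.≡-irrelevant Bool._≟_ a a′ = refl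

  edge-through : ∀ {x z} → Adj G x z → Σ (Edge G) λ e → (_∈ₑ_ {G} x e) × (_∈ₑ_ {G} z e)
  edge-through {x} {z} a with <-cmp x z
  ... | tri< x<z _ _ = ((x , z) , x<z , a) , inj₁ refl , inj₂ refl
  ... | tri≈ _ refl _ with () ← trans (sym a) (irrefl G x)
  ... | tri> _ _ z<x = ((z , x) , z<x , trans (Graph.sym G z x) a) , inj₂ refl , inj₁ refl

  incident-or-isolated : ∀ v → Incident v ⊎ Isolated v
  incident-or-isolated v with any? (λ w → adj G v w Bool.≟ true)
  ... | yes (w , a) = inj₁ (proj₁ (edge-through a) , proj₁ (proj₂ (edge-through a)))
  ... | no none = inj₂ λ w → Bool.¬-not λ a → none (w , a)

  edge? : Dec (Edge G)
  edge? with any? (λ u → any? (λ w → adj G u w Bool.≟ true))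
  ... | yes (u , w , a) = yes (proj₁ (edge-through a))
  ... | no none = no λ ((u , w) , _ , a) → none (u , w , a)

  isolated-within⇒≡ : ∀ {v u k} → Isolated v → Within (Adj G) k v u → v ≡ u
  isolated-within⇒≡ isolated here = refl
  isolated-within⇒≡ isolated (step {w = w} a _) with () ← trans (sym a) (isolated w)

  connected⇒incident : Connected G → Edge G → ∀ v → Incident v
  connected⇒incident conn ((x , y) , x<y , _) v with incident-or-isolated v
  ... | inj₁ incident = incident
  ... | inj₂ isolated
    with refl ← isolated-within⇒≡ isolated (proj₂ (conn v x))
       | refl ← isolated-within⇒≡ isolated (proj₂ (conn v y))
       = ⊥-elim (<-irrefl refl x<y)

  endpoints-within-1 : ∀ {x y} (e : Edge G) → _∈ₑ_ {G} x e → _∈ₑ_ {G} y e → Within (Adj G) 1 x y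
  endpoints-within-1 e                 (inj₁ refl) (inj₁ refl) = here
  endpoints-within-1 e                 (inj₂ refl) (inj₂ refl) = here
  endpoints-within-1 (_ , _ , a)       (inj₁ refl) (inj₂ refl) = step a here
  endpoints-within-1 ((x , y) , _ , a) (inj₂ refl) (inj₁ refl) = step (trans (Graph.sym G y x) a) here

  line-walk⇒walk : ∀ {k v w} (e f : Edge G) → _∈ₑ_ {G} v e →
    Within (LAdj G) k e f → _∈ₑ_ {G} w f → Within (Adj G) (suc k) v w
  line-walk⇒walk e .e v∈e here w∈e = within-≤ (s≤s z≤n) (endpoints-within-1 e v∈e w∈e)
  line-walk⇒walk e f v∈e (step {w = g} (_ , x , x∈e , x∈g) walk) w∈f =
    within-trans (endpoints-within-1 e v∈e x∈e) (line-walk⇒walk g f x∈g walk w∈f)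

  -- e and g may be the same edge, which L(G) does not regard as adjacent.
  line-step : ∀ {m x} (e g f : Edge G) → _∈ₑ_ {G} x e → _∈ₑ_ {G} x g →
    Within (LAdj G) m g f → Within (LAdj G) (suc m) e f
  line-step {m} {x} e g f x∈e x∈g walk with ≡-dec _≟_ _≟_ (proj₁ e) (proj₁ g)
  ... | yes e≡g = subst (λ h → Within (LAdj G) (suc m) h f) (sym (≡-Edge e≡g)) (within-≤ (n≤1+n m) walk)
  ... | no e≢g  = step (e≢g , x , x∈e , x∈g) walk

  walk⇒line-walk : ∀ {k x y} (e f : Edge G) → _∈ₑ_ {G} x e →
    Within (Adj G) k x y → _∈ₑ_ {G} y f → Within (LAdj G) (suc k) e f
  walk⇒line-walk e f x∈e here x∈f = within-≤ (s≤s z≤n) (line-step e f f x∈e x∈f here)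
  walk⇒line-walk e f x∈e (step a walk) y∈f with edge-through a
  ... | g , x∈g , z∈g = line-step e g f x∈e x∈g (walk⇒line-walk g f z∈g walk y∈f)

inhabited? : ∀ m → Fin m ⊎ ¬ Fin m
inhabited? zero    = inj₂ λ ()
inhabited? (suc m) = inj₁ fzero

vertexBurning≤edgeBurning+1 : (G : Graph) → Connected G → ∀ {b bL} →
  BurningNumber G b → EdgeBurningNumber G bL → b ≤ bL + 1
vertexBurning≤edgeBurning+1 G conn {bL = bL} Bb ((cs , burns) , _) with inhabited? (n G)
... | inj₂ empty = ≤-trans (burningNumber≤length Bb (λ ()) λ v → ⊥-elim (empty v)) z≤n
... | inj₁ v₀ = burningNumber≤length Bb (first ∘ cs ++ (v₀ ∷ [])) (burning-++ (first ∘ cs) v₀ covered)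
  where
  first : Edge G → Vtx G
  first e = proj₁ (proj₁ e)
  covered : ∀ v → v ≡ v₀ ⊎ ∃ λ j → Within (Adj G) (suc (bL ∸ suc (toℕ j))) v (first (cs j))
  covered v with incident-or-isolated G v
  ... | inj₂ isolated = inj₁ (isolated-within⇒≡ G isolated (proj₂ (conn v v₀)))
  ... | inj₁ (e , v∈e) with burns e
  ... | j , walk = inj₂ (j , line-walk⇒walk G e (cs j) v∈e walk (inj₁ refl))

edgeBurning≤vertexBurning+1 : (G : Graph) → Connected G → ∀ {b bL} →
  BurningNumber G b → EdgeBurningNumber G bL → bL ≤ b + 1
edgeBurning≤vertexBurning+1 G conn {b} ((bs , burns) , _) BbL with edge? G
... | no edgeless = ≤-trans (burningNumber≤length BbL (λ ()) λ e → ⊥-elim (edgeless e)) z≤n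
... | yes e₀ = burningNumber≤length BbL (on ∘ bs ++ (e₀ ∷ [])) (burning-++ (on ∘ bs) e₀ covered)
  where
  through : ∀ v → Incident G v
  through = connected⇒incident G conn e₀
  on : Vtx G → Edge G
  on v = proj₁ (through v)
  covered : ∀ e → e ≡ e₀ ⊎ ∃ λ j → Within (LAdj G) (suc (b ∸ suc (toℕ j))) e (on (bs j))
  covered e with burns (proj₁ (proj₁ e))
  ... | j , walk = inj₂ (j , walk⇒line-walk G e (on (bs j)) (inj₁ refl) walk (proj₂ (through (bs j))))

theorem5 : (G : Graph) → Connected G → (b bL : ℕ) →
    BurningNumber G b → EdgeBurningNumber G bL →
    (b ∸ 1 ≤ bL) × (bL ≤ b + 1)
theorem5 G conn b bL Bb BbL =
  subst (b ∸ 1 ≤_) (m+n∸n≡m bL 1) (∸-monoˡ-≤ 1 (vertexBurning≤edgeBurning+1 G conn Bb BbL)) ,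
  edgeBurning≤vertexBurning+1 G conn Bb BbL
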